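{- Let $n\ge2$, $r\ge1$ and $s\ge1$ be integers. Then $$\begin{vmatrix}F^{(n)}_{r+1}&F^{(n)}_{r+2}&\cdots&F^{(n)}_{r+n-1}&F^{(n)}_{r+n+s-1}\\ F^{(n)}_{r}&F^{(n)}_{r+1}&\cdots&F^{(n)}_{r+n-2}&F^{(n)}_{r+n+s-2}\\ \vdots&\vdots&\cdots&\vdots&\vdots\\ F^{(n)}_{r-n+2}&F^{(n)}_{r-n+3}&\cdots&F^{(n)}_{r}&F^{(n)}_{r+s} \end{vmatrix}=(-1)^{(n-1)r}\cdot F^{(n)}_{s},$$ i.e. the $n\times n$ determinant whose $(i,j)$ entry is $F^{(n)}_{r+1+j-i}$ for $1\le i\le n$, $1\le j\le n-1$, and whose $(i,n)$ entry is $F^{(n)}_{r+n+s-i}$, equals $(-1)^{(n-1)r}F^{(n)}_s$.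
   Context: For an integer $n\ge2$, the $n$-step Fibonacci numbers $F^{(n)}_k$, $k\ge -(n-2)$, are defined by $F^{(n)}_k=0$ for $-(n-2)\le k\le 0$, $F^{(n)}_1=1$, and $F^{(n)}_k=F^{(n)}_{k-1}+F^{(n)}_{k-2}+\cdots+F^{(n)}_{k-n}$ for $k\ge2$. Thus $F^{(n)}_1=F^{(n)}_2=1$, $F^{(n)}_3=2$, …, $F^{(n)}_{n+1}=2^{n-1}$. -}

module Defs where

open import Data.Nat as ℕ using (ℕ; zero; suc)
open import Data.Integer as ℤ using (ℤ; +_; -[1+_]; _+_; _*_; -_; 0ℤ)
open import Data.Fin using (Fin; zero; suc; punchIn; toℕ)
open import Data.List using (List; []; _∷_)

mutual
  fibN : ℕ → ℕ → ℕ
  fibN n zero = 0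
  fibN n (suc zero) = 1
  fibN n (suc (suc k)) = sumBack n n (suc k)

  -- sumBack n m j = F_j + F_{j-1} + ... + F_{j-m+1}  (terms with index ≤ 0 are 0)
  -- defined by recursion on m, with j ≤ current index so the recursion is structural on j
  sumBack : ℕ → ℕ → ℕ → ℕ
  sumBack n zero j = 0
  sumBack n (suc m) zero = 0
  sumBack n (suc m) (suc j) = fibN n (suc j) ℕ.+ sumBack n m j

-- F^{(n)}_k for an integer index k; equals 0 for every k ≤ 0
-- (the paper only uses k ≥ -(n-2), where F is defined to be 0 for k ≤ 0).
F : ℕ → ℤ → ℤ
F n (+ k) = + fibN n k
F n -[1+ k ] = 0ℤ

sgn : ℕ → ℤ
sgn zero = + 1
sgn (suc zero) = - (+ 1)
sgn (suc (suc t)) = sgn t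

Σ : (m : ℕ) → (Fin m → ℤ) → ℤ
Σ zero f = 0ℤ
Σ (suc m) f = f zero + Σ m (λ j → f (suc j))

det : (m : ℕ) → (Fin m → Fin m → ℤ) → ℤ
det zero A = + 1
det (suc m) A =
  Σ (suc m) (λ j → sgn (toℕ j) * (A zero j * det m (λ i k → A (suc i) (punchIn j k))))

-- The rows of the matrix are consecutive terms of the vector sequence
-- v_t = (F_{t-n+2}, …, F_t, F_{t+s}), which satisfies the n-step recurrence componentwise
-- (F_k = 0 for k ≤ 0 makes the recurrence hold down to index 2). Subtracting the other
-- n - 1 rows from the first turns the matrix for r + 1 into the matrix for r with its last
-- row moved to the top, a cyclic shift of n rows and hence a sign (-1)^(n-1). For r = 0 the
-- first n - 1 columns are upper unitriangular (F₁ = 1 and F_k = 0 for k ≤ 0), so the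
-- determinant is the bottom entry F_s of the last column.
module Submission where

open import Defs
open import Data.Nat using (ℕ; suc; _≥_; _∸_; _<ᵇ_)
open import Data.Integer using (ℤ; +_; _-_; _*_)
open import Data.Bool using (if_then_else_)
open import Data.Fin using (Fin; toℕ)
open import Relation.Binary.PropositionalEquality using (_≡_)

open import Data.Nat as ℕ using (zero; _<_)
import Data.Nat.Properties as ℕP
open import Data.Integer using (_+_; -_; 0ℤ; _⊖_)
import Data.Integer.Properties as ℤP
open import Data.Fin using (zero; suc; punchIn; inject₁; fromℕ)
open import Data.Fin.Properties using (toℕ<n; toℕ-inject₁; toℕ-fromℕ)
open import Data.Bool using (true; false)
open import Data.Sum using (inj₁; inj₂)
open import Function using (_∘_)
open import Relation.Binary.PropositionalEquality
open import Algebra.Properties.Semiring.Sum ℤP.+-*-semiring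
  using (sum; sum-cong-≗; ∑-distrib-+; ∑-comm; sum-init-last; *-distribˡ-sum; sum-replicate-zero)
open import Algebra.Properties.AbelianGroup ℤP.+-0-abelianGroup using (inverseˡ-unique)
open import Data.Integer.Tactic.RingSolver using (solve-∀)
import Data.Nat.Tactic.RingSolver as ℕ-Solver
open ≡-Reasoning

Σ≡sum : ∀ m (f : Fin m → ℤ) → Σ m f ≡ sum f
Σ≡sum zero    f = refl
Σ≡sum (suc m) f = cong (λ z → f zero + z) (Σ≡sum m (f ∘ suc))

Σ-cong : ∀ m {f g : Fin m → ℤ} → (∀ i → f i ≡ g i) → Σ m f ≡ Σ m g
Σ-cong m {f} {g} f≗g = trans (Σ≡sum m f) (trans (sum-cong-≗ f≗g) (sym (Σ≡sum m g)))

Σ-zero : ∀ m {f : Fin m → ℤ} → (∀ i → f i ≡ 0ℤ) → Σ m f ≡ 0ℤ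
Σ-zero m f≗0 = trans (Σ-cong m f≗0) (trans (Σ≡sum m _) (sum-replicate-zero m))

Σ-+ : ∀ m (f g : Fin m → ℤ) → Σ m (λ i → f i + g i) ≡ Σ m f + Σ m g
Σ-+ m f g = trans (Σ≡sum m _) (trans (∑-distrib-+ f g) (sym (cong₂ _+_ (Σ≡sum m f) (Σ≡sum m g))))

*-distribˡ-Σ : ∀ m x (f : Fin m → ℤ) → x * Σ m f ≡ Σ m (λ i → x * f i)
*-distribˡ-Σ m x f = trans (cong (x *_) (Σ≡sum m f)) (trans (*-distribˡ-sum x f) (sym (Σ≡sum m _)))

Σ-comm : ∀ m p (f : Fin m → Fin p → ℤ) → Σ m (λ i → Σ p (f i)) ≡ Σ p (λ j → Σ m (λ i → f i j))
Σ-comm m p f = begin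
  Σ m (λ i → Σ p (f i))              ≡⟨ Σ-cong m (λ i → Σ≡sum p (f i)) ⟩
  Σ m (λ i → sum (f i))              ≡⟨ Σ≡sum m _ ⟩
  sum (λ i → sum (f i))              ≡⟨ ∑-comm f ⟩
  sum (λ j → sum (λ i → f i j))      ≡⟨ sym (Σ≡sum p _) ⟩
  Σ p (λ j → sum (λ i → f i j))      ≡⟨ Σ-cong p (λ j → sym (Σ≡sum m _)) ⟩
  Σ p (λ j → Σ m (λ i → f i j))      ∎

Σ-init-last : ∀ m (f : Fin (suc m) → ℤ) → Σ (suc m) f ≡ Σ m (f ∘ inject₁) + f (fromℕ m)
Σ-init-last m f =
  trans (Σ≡sum (suc m) f) (trans (sum-init-last f) (cong (_+ f (fromℕ m)) (sym (Σ≡sum m _))))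

Σ-firstRow+firstColumn : ∀ m (W : Fin (suc (suc m)) → Fin (suc m) → ℤ) →
  Σ (suc (suc m)) (λ j → Σ (suc m) (W j))
    ≡ Σ (suc m) (λ k → W zero k + W (suc k) zero) + Σ (suc m) (λ j → Σ m (W (suc j) ∘ suc))
Σ-firstRow+firstColumn m W = begin
  Σ (suc m) (W zero) + Σ (suc m) (λ j → W (suc j) zero + Σ m (W (suc j) ∘ suc))
    ≡⟨ cong (λ z → Σ (suc m) (W zero) + z)
            (Σ-+ (suc m) (λ j → W (suc j) zero) (λ j → Σ m (W (suc j) ∘ suc))) ⟩
  Σ (suc m) (W zero) + (Σ (suc m) (λ j → W (suc j) zero) + Σ (suc m) (λ j → Σ m (W (suc j) ∘ suc)))
    ≡⟨ sym (ℤP.+-assoc (Σ (suc m) (W zero)) _ _) ⟩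
  Σ (suc m) (W zero) + Σ (suc m) (λ j → W (suc j) zero) + Σ (suc m) (λ j → Σ m (W (suc j) ∘ suc))
    ≡⟨ cong (_+ Σ (suc m) (λ j → Σ m (W (suc j) ∘ suc)))
            (sym (Σ-+ (suc m) (W zero) (λ k → W (suc k) zero))) ⟩
  Σ (suc m) (λ k → W zero k + W (suc k) zero) + Σ (suc m) (λ j → Σ m (W (suc j) ∘ suc)) ∎

sgn-suc : ∀ t → sgn (suc t) ≡ - sgn t
sgn-suc zero          = refl
sgn-suc (suc zero)    = refl
sgn-suc (suc (suc t)) = sgn-suc t

sgn-+ : ∀ a b → sgn (a ℕ.+ b) ≡ sgn a * sgn b
sgn-+ zero          b = sym (ℤP.*-identityˡ (sgn b))
sgn-+ (suc zero)    b = trans (sgn-suc b) (sym (ℤP.-1*i≡-i (sgn b)))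
sgn-+ (suc (suc a)) b = sgn-+ a b

Matrix : ℕ → Set
Matrix m = Fin m → Fin m → ℤ

minor₀ : ∀ {m} → Matrix (suc m) → Fin (suc m) → Matrix m
minor₀ A j i k = A (suc i) (punchIn j k)

det-cong : ∀ m {A B : Matrix m} → (∀ i j → A i j ≡ B i j) → det m A ≡ det m B
det-cong zero    A≗B = refl
det-cong (suc m) A≗B = Σ-cong (suc m) λ j →
  cong (sgn (toℕ j) *_) (cong₂ _*_ (A≗B zero j) (det-cong m (λ i k → A≗B (suc i) (punchIn j k))))

-- Expansion along the first two rows. Without function extensionality the minor of the
-- remaining rows is a function D of the chosen columns that must respect pointwise equality.
ColumnFunctional : ℕ → Set
ColumnFunctional m = (Fin m → Fin (suc (suc m))) → ℤ

Extensional : ∀ {m} → ColumnFunctional m → Set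
Extensional D = ∀ f g → (∀ l → f l ≡ g l) → D f ≡ D g

laplace₂ : ∀ {m} (a b : Fin (suc (suc m)) → ℤ) → ColumnFunctional m →
           Fin (suc (suc m)) → Fin (suc m) → ℤ
laplace₂ a b D j k = sgn (toℕ j) * (a j * (sgn (toℕ k) * (b (punchIn j k) * D (punchIn j ∘ punchIn k))))

lowerMinor : ∀ m → Matrix (suc (suc m)) → ColumnFunctional m
lowerMinor m A f = det m (λ i l → A (suc (suc i)) (f l))

lowerMinor-extensional : ∀ m A → Extensional (lowerMinor m A)
lowerMinor-extensional m A f g f≗g = det-cong m (λ i l → cong (A (suc (suc i))) (f≗g l))

det-laplace₂ : ∀ m (A : Matrix (suc (suc m))) →
  det (suc (suc m)) A ≡ Σ (suc (suc m)) (λ j → Σ (suc m) (laplace₂ (A zero) (A (suc zero)) (lowerMinor m A) j))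
det-laplace₂ m A = Σ-cong (suc (suc m)) λ j → begin
  sgn (toℕ j) * (A zero j * Σ (suc m) (R j))
    ≡⟨ cong (sgn (toℕ j) *_) (*-distribˡ-Σ (suc m) (A zero j) (R j)) ⟩
  sgn (toℕ j) * Σ (suc m) (λ k → A zero j * R j k)
    ≡⟨ *-distribˡ-Σ (suc m) (sgn (toℕ j)) (λ k → A zero j * R j k) ⟩
  Σ (suc m) (laplace₂ (A zero) (A (suc zero)) (lowerMinor m A) j) ∎
  where
  R : Fin (suc (suc m)) → Fin (suc m) → ℤ
  R j k = sgn (toℕ k) * (A (suc zero) (punchIn j k) * lowerMinor m A (punchIn j ∘ punchIn k))

laplace₂-cross : ∀ S a₀ b₀ aₖ bₖ X →
  (+ 1 * (a₀ * (S * (bₖ * X))) + + 1 * (b₀ * (S * (aₖ * X)))) +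
  ((- S) * (aₖ * (+ 1 * (b₀ * X))) + (- S) * (bₖ * (+ 1 * (a₀ * X)))) ≡ 0ℤ
laplace₂-cross = solve-∀

laplace₂-firstRow-cancel : ∀ m (a b : Fin (suc (suc m)) → ℤ) (D : ColumnFunctional m) (k : Fin (suc m)) →
  (laplace₂ a b D zero k + laplace₂ b a D zero k)
    + (laplace₂ a b D (suc k) zero + laplace₂ b a D (suc k) zero) ≡ 0ℤ
laplace₂-firstRow-cancel m a b D k rewrite sgn-suc (toℕ k) =
  laplace₂-cross (sgn (toℕ k)) (a zero) (b zero) (a (suc k)) (b (suc k)) (D (suc ∘ punchIn k))

signs-flip : ∀ S T x y X → (- S) * (x * ((- T) * (y * X))) ≡ S * (x * (T * (y * X)))
signs-flip = solve-∀

prependZero : ∀ {m} → (Fin m → Fin (suc (suc m))) → Fin (suc m) → Fin (suc (suc (suc m)))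
prependZero f zero    = zero
prependZero f (suc l) = suc (f l)

laplace₂-suc : ∀ m (a b : Fin (suc (suc (suc m))) → ℤ) (D : ColumnFunctional (suc m)) → Extensional D →
  ∀ j k → laplace₂ a b D (suc j) (suc k) ≡ laplace₂ (a ∘ suc) (b ∘ suc) (D ∘ prependZero) j k
laplace₂-suc m a b D D-ext j k = begin
  sgn (suc (toℕ j)) * (a (suc j) * (sgn (suc (toℕ k)) * (b (suc (punchIn j k)) * X)))
    ≡⟨ cong₂ (λ S T → S * (a (suc j) * (T * (b (suc (punchIn j k)) * X))))
             (sgn-suc (toℕ j)) (sgn-suc (toℕ k)) ⟩
  - sgn (toℕ j) * (a (suc j) * (- sgn (toℕ k) * (b (suc (punchIn j k)) * X)))
    ≡⟨ signs-flip (sgn (toℕ j)) (sgn (toℕ k)) (a (suc j)) (b (suc (punchIn j k))) X ⟩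
  sgn (toℕ j) * (a (suc j) * (sgn (toℕ k) * (b (suc (punchIn j k)) * X)))
    ≡⟨ cong (λ Y → sgn (toℕ j) * (a (suc j) * (sgn (toℕ k) * (b (suc (punchIn j k)) * Y))))
            (D-ext _ _ λ { zero → refl ; (suc l) → refl }) ⟩
  laplace₂ (a ∘ suc) (b ∘ suc) (D ∘ prependZero) j k ∎
  where
  X : ℤ
  X = D (punchIn (suc j) ∘ punchIn (suc k))

-- The (j,k) term of one ordering of the two rows cancels the (k+1,0) term of the other;
-- the remaining terms form the same sum one size smaller.
mutual
  laplace₂-antisym : ∀ m (a b : Fin (suc (suc m)) → ℤ) (D : ColumnFunctional m) → Extensional D →
    Σ (suc (suc m)) (λ j → Σ (suc m) (λ k → laplace₂ a b D j k + laplace₂ b a D j k)) ≡ 0ℤ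
  laplace₂-antisym m a b D D-ext = begin
    Σ (suc (suc m)) (λ j → Σ (suc m) (V j))
      ≡⟨ Σ-firstRow+firstColumn m V ⟩
    Σ (suc m) (λ k → V zero k + V (suc k) zero) + Σ (suc m) (λ j → Σ m (V (suc j) ∘ suc))
      ≡⟨ cong₂ _+_ (Σ-zero (suc m) (laplace₂-firstRow-cancel m a b D))
                   (laplace₂-antisym-lower m a b D D-ext) ⟩
    0ℤ ∎
    where
    V : Fin (suc (suc m)) → Fin (suc m) → ℤ
    V j k = laplace₂ a b D j k + laplace₂ b a D j k

  laplace₂-antisym-lower : ∀ m (a b : Fin (suc (suc m)) → ℤ) (D : ColumnFunctional m) → Extensional D →
    Σ (suc m) (λ j → Σ m (λ k → laplace₂ a b D (suc j) (suc k) + laplace₂ b a D (suc j) (suc k))) ≡ 0ℤ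
  laplace₂-antisym-lower zero    a b D D-ext = refl
  laplace₂-antisym-lower (suc m) a b D D-ext =
    trans (Σ-cong (suc (suc m)) λ j → Σ-cong (suc m) λ k →
             cong₂ _+_ (laplace₂-suc m a b D D-ext j k) (laplace₂-suc m b a D D-ext j k))
          (laplace₂-antisym m (a ∘ suc) (b ∘ suc) (D ∘ prependZero)
             (λ f g f≗g → D-ext _ _ λ { zero → refl ; (suc l) → cong suc (f≗g l) }))

swap₀₁ : ∀ {m} → Fin (suc (suc m)) → Fin (suc (suc m))
swap₀₁ zero          = suc zero
swap₀₁ (suc zero)    = zero
swap₀₁ (suc (suc i)) = suc (suc i)

det-swap₀₁ : ∀ m (A : Matrix (suc (suc m))) → det (suc (suc m)) A + det (suc (suc m)) (A ∘ swap₀₁) ≡ 0ℤ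
det-swap₀₁ m A = begin
  det (suc (suc m)) A + det (suc (suc m)) (A ∘ swap₀₁)
    ≡⟨ cong₂ _+_ (det-laplace₂ m A) (det-laplace₂ m (A ∘ swap₀₁)) ⟩
  Σ (suc (suc m)) (λ j → Σ (suc m) (U a b j)) + Σ (suc (suc m)) (λ j → Σ (suc m) (U b a j))
    ≡⟨ sym (Σ-+ (suc (suc m)) (λ j → Σ (suc m) (U a b j)) (λ j → Σ (suc m) (U b a j))) ⟩
  Σ (suc (suc m)) (λ j → Σ (suc m) (U a b j) + Σ (suc m) (U b a j))
    ≡⟨ Σ-cong (suc (suc m)) (λ j → sym (Σ-+ (suc m) (U a b j) (U b a j))) ⟩
  Σ (suc (suc m)) (λ j → Σ (suc m) (λ k → U a b j k + U b a j k))
    ≡⟨ laplace₂-antisym m a b (lowerMinor m A) (lowerMinor-extensional m A) ⟩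
  0ℤ ∎
  where
  a b : Fin (suc (suc m)) → ℤ
  a = A zero
  b = A (suc zero)
  U : (Fin (suc (suc m)) → ℤ) → (Fin (suc (suc m)) → ℤ) → Fin (suc (suc m)) → Fin (suc m) → ℤ
  U x y = laplace₂ x y (lowerMinor m A)

x+x≡0⇒x≡0 : ∀ {x : ℤ} → x + x ≡ 0ℤ → x ≡ 0ℤ
x+x≡0⇒x≡0 {+ zero} _ = refl

sgn*[x*0]≡0 : ∀ j x → sgn j * (x * 0ℤ) ≡ 0ℤ
sgn*[x*0]≡0 j x = trans (cong (sgn j *_) (ℤP.*-zeroʳ x)) (ℤP.*-zeroʳ (sgn j))

det-equalRows : ∀ m (A : Matrix (suc m)) (i : Fin m) → (∀ j → A zero j ≡ A (suc i) j) → det (suc m) A ≡ 0ℤ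
det-equalRows (suc m) A zero A₀≗A₁ =
  x+x≡0⇒x≡0 (trans (cong (λ z → det (suc (suc m)) A + z) (det-cong (suc (suc m)) A≗A∘swap))
                   (det-swap₀₁ m A))
  where
  A≗A∘swap : ∀ i j → A i j ≡ A (swap₀₁ i) j
  A≗A∘swap zero          j = A₀≗A₁ j
  A≗A∘swap (suc zero)    j = sym (A₀≗A₁ j)
  A≗A∘swap (suc (suc i)) j = refl
det-equalRows (suc m) A (suc i) A₀≗Aᵢ = begin
  det (suc (suc m)) A
    ≡⟨ inverseˡ-unique _ _ (det-swap₀₁ m A) ⟩
  - det (suc (suc m)) (A ∘ swap₀₁)
    ≡⟨ cong -_ (Σ-zero (suc (suc m)) λ j →
         trans (cong (λ z → sgn (toℕ j) * (A (suc zero) j * z))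
                     (det-equalRows m (minor₀ (A ∘ swap₀₁) j) i (λ k → A₀≗Aᵢ (punchIn j k))))
               (sgn*[x*0]≡0 (toℕ j) (A (suc zero) j))) ⟩
  0ℤ ∎

-- cycle i = i + 1 for i < m and cycle m = 0, so A ∘ cycle moves the first row of A to the bottom.
cycle : ∀ {m} → Fin (suc m) → Fin (suc m)
cycle {zero}  zero    = zero
cycle {suc m} zero    = suc zero
cycle {suc m} (suc i) = swap₀₁ (suc (cycle i))

swap₀₁-suc-nonzero : ∀ {m} (x : Fin (suc m)) {t} → toℕ x ≡ suc t → swap₀₁ (suc x) ≡ suc x
swap₀₁-suc-nonzero (suc x) _ = refl

swap₀₁-suc-zero : ∀ {m} (x : Fin (suc m)) → toℕ x ≡ 0 → swap₀₁ (suc x) ≡ zero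
swap₀₁-suc-zero zero _ = refl

toℕ-cycle-< : ∀ {m} (i : Fin (suc m)) → toℕ i < m → toℕ (cycle i) ≡ suc (toℕ i)
toℕ-cycle-< {suc m} zero    _           = refl
toℕ-cycle-< {suc m} (suc i) (ℕ.s≤s i<m) =
  trans (cong toℕ (swap₀₁-suc-nonzero (cycle i) (toℕ-cycle-< i i<m))) (cong suc (toℕ-cycle-< i i<m))

toℕ-cycle-last : ∀ {m} (i : Fin (suc m)) → toℕ i ≡ m → toℕ (cycle i) ≡ 0
toℕ-cycle-last {zero}  zero    _   = refl
toℕ-cycle-last {suc m} (suc i) i≡m =
  cong toℕ (swap₀₁-suc-zero (cycle i) (toℕ-cycle-last i (ℕP.suc-injective i≡m)))

det-cycle : ∀ m (A : Matrix (suc m)) → det (suc m) A ≡ sgn m * det (suc m) (A ∘ cycle)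
det-cycle zero    A = sym (ℤP.*-identityˡ _)
det-cycle (suc m) A = begin
  det (suc (suc m)) A
    ≡⟨ inverseˡ-unique _ _ (det-swap₀₁ m A) ⟩
  - Σ (suc (suc m)) (λ j → sgn (toℕ j) * (A (suc zero) j * det (suc m) (minor₀ (A ∘ swap₀₁) j)))
    ≡⟨ cong -_ (Σ-cong (suc (suc m)) λ j → trans
         (cong (λ z → sgn (toℕ j) * (A (suc zero) j * z)) (det-cycle m (minor₀ (A ∘ swap₀₁) j)))
         (move (sgn (toℕ j)) (A (suc zero) j) (sgn m) (det (suc m) (minor₀ (A ∘ cycle) j)))) ⟩
  - Σ (suc (suc m)) (λ j → sgn m * (sgn (toℕ j) * (A (suc zero) j * det (suc m) (minor₀ (A ∘ cycle) j))))
    ≡⟨ cong -_ (sym (*-distribˡ-Σ (suc (suc m)) (sgn m)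
                      (λ j → sgn (toℕ j) * (A (suc zero) j * det (suc m) (minor₀ (A ∘ cycle) j))))) ⟩
  - (sgn m * det (suc (suc m)) (A ∘ cycle))
    ≡⟨ ℤP.neg-distribˡ-* (sgn m) (det (suc (suc m)) (A ∘ cycle)) ⟩
  - sgn m * det (suc (suc m)) (A ∘ cycle)
    ≡⟨ cong (_* det (suc (suc m)) (A ∘ cycle)) (sym (sgn-suc m)) ⟩
  sgn (suc m) * det (suc (suc m)) (A ∘ cycle) ∎
  where
  move : ∀ s a t x → s * (a * (t * x)) ≡ t * (s * (a * x))
  move = solve-∀

replaceHead : ∀ {m} → (Fin (suc m) → ℤ) → Matrix (suc m) → Matrix (suc m)
replaceHead x A zero    = x
replaceHead x A (suc i) = A (suc i)

det-replaceHead-+ : ∀ m (x y : Fin (suc m) → ℤ) (A : Matrix (suc m)) →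
  det (suc m) (replaceHead (λ j → x j + y j) A) ≡ det (suc m) (replaceHead x A) + det (suc m) (replaceHead y A)
det-replaceHead-+ m x y A = trans (Σ-cong (suc m) distrib) (Σ-+ (suc m) (term x) (term y))
  where
  term : (Fin (suc m) → ℤ) → Fin (suc m) → ℤ
  term z j = sgn (toℕ j) * (z j * det m (minor₀ A j))
  distrib : ∀ j → sgn (toℕ j) * ((x j + y j) * det m (minor₀ A j)) ≡ term x j + term y j
  distrib j = trans (cong (sgn (toℕ j) *_) (ℤP.*-distribʳ-+ (det m (minor₀ A j)) (x j) (y j)))
                    (ℤP.*-distribˡ-+ (sgn (toℕ j)) (x j * det m (minor₀ A j)) (y j * det m (minor₀ A j)))

det-replaceHead-Σ : ∀ m p (v : Fin p → Fin (suc m) → ℤ) (A : Matrix (suc m)) →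
  det (suc m) (replaceHead (λ j → Σ p (λ i → v i j)) A) ≡ Σ p (λ i → det (suc m) (replaceHead (v i) A))
det-replaceHead-Σ m p v A = trans (Σ-cong (suc m) distrib) (Σ-comm (suc m) p term)
  where
  term : Fin (suc m) → Fin p → ℤ
  term j i = sgn (toℕ j) * (v i j * det m (minor₀ A j))
  distrib : ∀ j → sgn (toℕ j) * (Σ p (λ i → v i j) * det m (minor₀ A j)) ≡ Σ p (term j)
  distrib j = begin
    sgn (toℕ j) * (Σ p (λ i → v i j) * M)
      ≡⟨ cong (sgn (toℕ j) *_) (ℤP.*-comm (Σ p (λ i → v i j)) M) ⟩
    sgn (toℕ j) * (M * Σ p (λ i → v i j))
      ≡⟨ cong (sgn (toℕ j) *_) (*-distribˡ-Σ p M (λ i → v i j)) ⟩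
    sgn (toℕ j) * Σ p (λ i → M * v i j)
      ≡⟨ cong (sgn (toℕ j) *_) (Σ-cong p λ i → ℤP.*-comm M (v i j)) ⟩
    sgn (toℕ j) * Σ p (λ i → v i j * M)
      ≡⟨ *-distribˡ-Σ p (sgn (toℕ j)) (λ i → v i j * M) ⟩
    Σ p (term j) ∎
    where
    M : ℤ
    M = det m (minor₀ A j)

det-addRowsToHead : ∀ m (A : Matrix (suc m)) (y : Fin (suc m) → ℤ) →
  (∀ j → A zero j ≡ y j + Σ m (λ i → A (suc i) j)) → det (suc m) A ≡ det (suc m) (replaceHead y A)
det-addRowsToHead m A y A₀≡y+rows = begin
  det (suc m) A
    ≡⟨ det-cong (suc m) {A = A} {B = replaceHead (λ j → y j + Σ m (λ i → A (suc i) j)) A}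
                (λ { zero j → A₀≡y+rows j ; (suc i) j → refl }) ⟩
  det (suc m) (replaceHead (λ j → y j + Σ m (λ i → A (suc i) j)) A)
    ≡⟨ det-replaceHead-+ m y (λ j → Σ m (λ i → A (suc i) j)) A ⟩
  det (suc m) (replaceHead y A) + det (suc m) (replaceHead (λ j → Σ m (λ i → A (suc i) j)) A)
    ≡⟨ cong (λ z → det (suc m) (replaceHead y A) + z) (det-replaceHead-Σ m m (A ∘ suc) A) ⟩
  det (suc m) (replaceHead y A) + Σ m (λ i → det (suc m) (replaceHead (A (suc i)) A))
    ≡⟨ cong (λ z → det (suc m) (replaceHead y A) + z)
            (Σ-zero m λ i → det-equalRows m (replaceHead (A (suc i)) A) i (λ j → refl)) ⟩
  det (suc m) (replaceHead y A) + 0ℤ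
    ≡⟨ ℤP.+-identityʳ (det (suc m) (replaceHead y A)) ⟩
  det (suc m) (replaceHead y A) ∎

det-zeroFirstColumn : ∀ m (A : Matrix (suc m)) → (∀ i → A i zero ≡ 0ℤ) → det (suc m) A ≡ 0ℤ
det-zeroFirstColumn m A col≡0 = Σ-zero (suc m) (term m A col≡0)
  where
  term : ∀ m (A : Matrix (suc m)) → (∀ i → A i zero ≡ 0ℤ) → ∀ j →
         sgn (toℕ j) * (A zero j * det m (minor₀ A j)) ≡ 0ℤ
  term m       A col≡0 zero rewrite col≡0 zero = ℤP.*-zeroʳ (sgn 0)
  term (suc m) A col≡0 (suc j) rewrite det-zeroFirstColumn m (minor₀ A (suc j)) (col≡0 ∘ suc) =
    sgn*[x*0]≡0 (toℕ (suc j)) (A zero (suc j))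

det-firstColumnZeroBelow : ∀ m (A : Matrix (suc m)) → (∀ i → A (suc i) zero ≡ 0ℤ) →
  det (suc m) A ≡ A zero zero * det m (minor₀ A zero)
det-firstColumnZeroBelow zero    A _       = trans (ℤP.+-identityʳ _) (ℤP.*-identityˡ _)
det-firstColumnZeroBelow (suc m) A below≡0 = begin
  + 1 * (A zero zero * M₀)
    + Σ (suc m) (λ j → sgn (toℕ (suc j)) * (A zero (suc j) * det (suc m) (minor₀ A (suc j))))
    ≡⟨ cong (λ z → + 1 * (A zero zero * M₀) + z) (Σ-zero (suc m) λ j →
         trans (cong (λ z → sgn (toℕ (suc j)) * (A zero (suc j) * z))
                     (det-zeroFirstColumn m (minor₀ A (suc j)) below≡0))
               (sgn*[x*0]≡0 (toℕ (suc j)) (A zero (suc j)))) ⟩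
  + 1 * (A zero zero * M₀) + 0ℤ
    ≡⟨ trans (ℤP.+-identityʳ _) (ℤP.*-identityˡ _) ⟩
  A zero zero * M₀ ∎
  where
  M₀ : ℤ
  M₀ = det (suc m) (minor₀ A zero)

F-cong-∸ : ∀ n a b c d → a ℕ.+ d ≡ c ℕ.+ b → F n (+ a - + b) ≡ F n (+ c - + d)
F-cong-∸ n a b c d a+d≡c+b = cong (F n) (begin
  + a - + b              ≡⟨ ℤP.m-n≡m⊖n a b ⟩
  a ⊖ b                  ≡⟨ sym (ℤP.+-cancelˡ-⊖ d a b) ⟩
  (d ℕ.+ a) ⊖ (d ℕ.+ b)  ≡⟨ cong₂ _⊖_ (trans (ℕP.+-comm d a) (trans a+d≡c+b (ℕP.+-comm c b)))
                                        (ℕP.+-comm d b) ⟩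
  (b ℕ.+ c) ⊖ (b ℕ.+ d)  ≡⟨ ℤP.+-cancelˡ-⊖ b c d ⟩
  c ⊖ d                  ≡⟨ sym (ℤP.m-n≡m⊖n c d) ⟩
  + c - + d              ∎)

F-cong-∸₀ : ∀ n a b c → a ≡ c ℕ.+ b → F n (+ a - + b) ≡ F n (+ c)
F-cong-∸₀ n a b c a≡c+b =
  trans (F-cong-∸ n a b c 0 (trans (ℕP.+-identityʳ a) a≡c+b)) (cong (F n) (ℤP.+-identityʳ (+ c)))

F-nonpositive : ∀ n k → F n (+ 0 - + k) ≡ 0ℤ
F-nonpositive n zero    = refl
F-nonpositive n (suc k) = refl

sumBack≡Σ : ∀ n m j → + sumBack n m j ≡ Σ m (λ i → F n (+ j - + toℕ i))
sumBack≡Σ n zero    j       = refl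
sumBack≡Σ n (suc m) zero    =
  sym (trans (ℤP.+-identityˡ _) (Σ-zero m (λ i → F-nonpositive n (suc (toℕ i)))))
sumBack≡Σ n (suc m) (suc j) = begin
  + (fibN n (suc j) ℕ.+ sumBack n m j)
    ≡⟨ ℤP.pos-+ (fibN n (suc j)) (sumBack n m j) ⟩
  + fibN n (suc j) + + sumBack n m j
    ≡⟨ cong₂ _+_ (sym (F-cong-∸₀ n (suc j) 0 (suc j) (sym (ℕP.+-identityʳ (suc j)))))
                 (trans (sumBack≡Σ n m j) (Σ-cong m λ i →
                    F-cong-∸ n j (toℕ i) (suc j) (suc (toℕ i)) (ℕP.+-suc j (toℕ i)))) ⟩
  F n (+ suc j - + 0) + Σ m (λ i → F n (+ suc j - + suc (toℕ i))) ∎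

F-recurrence : ∀ n k → F n (+ suc (suc k)) ≡ Σ n (λ i → F n (+ suc k - + toℕ i))
F-recurrence n k = sumBack≡Σ n n (suc k)

F-recurrence-last : ∀ m k → F (suc m) (+ suc (suc k))
  ≡ F (suc m) (+ suc k - + m) + Σ m (λ i → F (suc m) (+ suc k - + toℕ i))
F-recurrence-last m k = begin
  F (suc m) (+ suc (suc k))
    ≡⟨ F-recurrence (suc m) k ⟩
  Σ (suc m) G
    ≡⟨ Σ-init-last m G ⟩
  Σ m (G ∘ inject₁) + G (fromℕ m)
    ≡⟨ ℤP.+-comm (Σ m (G ∘ inject₁)) (G (fromℕ m)) ⟩
  G (fromℕ m) + Σ m (G ∘ inject₁)
    ≡⟨ cong₂ _+_ (cong (λ t → F (suc m) (+ suc k - + t)) (toℕ-fromℕ m))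
                 (Σ-cong m λ i → cong (λ t → F (suc m) (+ suc k - + t)) (toℕ-inject₁ i)) ⟩
  F (suc m) (+ suc k - + m) + Σ m (λ i → F (suc m) (+ suc k - + toℕ i)) ∎
  where
  G : Fin (suc m) → ℤ
  G i = F (suc m) (+ suc k - + toℕ i)

-- An upper unitriangular block (F₁ = 1 on the diagonal, F_k = 0 for k ≤ 0 below it)
-- followed by an arbitrary last column.
det-fibStaircase : ∀ n p (H : ℕ → ℤ) →
  det (suc p) (λ i j → if toℕ j <ᵇ p then F n (+ suc (toℕ j) - + toℕ i) else H (p ∸ toℕ i)) ≡ H 0
det-fibStaircase n zero    H = base (H 0)
  where
  base : ∀ h → + 1 * (h * + 1) + 0ℤ ≡ h
  base = solve-∀
det-fibStaircase n (suc p) H = begin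
  det (suc (suc p)) A
    ≡⟨ det-firstColumnZeroBelow (suc p) A (λ i →
         trans (F-cong-∸ n 1 (suc (toℕ i)) 0 (toℕ i) refl) (F-nonpositive n (toℕ i))) ⟩
  + 1 * det (suc p) (minor₀ A zero)
    ≡⟨ cong (+ 1 *_) (det-cong (suc p) shift) ⟩
  + 1 * det (suc p) (λ i j → if toℕ j <ᵇ p then F n (+ suc (toℕ j) - + toℕ i) else H (p ∸ toℕ i))
    ≡⟨ cong (+ 1 *_) (det-fibStaircase n p H) ⟩
  + 1 * H 0
    ≡⟨ ℤP.*-identityˡ (H 0) ⟩
  H 0 ∎
  where
  A : Matrix (suc (suc p))
  A i j = if toℕ j <ᵇ suc p then F n (+ suc (toℕ j) - + toℕ i) else H (suc p ∸ toℕ i)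
  shift : ∀ i j → minor₀ A zero i j
                ≡ (if toℕ j <ᵇ p then F n (+ suc (toℕ j) - + toℕ i) else H (p ∸ toℕ i))
  shift i j with toℕ j <ᵇ p
  ... | true  = F-cong-∸ n (suc (suc (toℕ j))) (suc (toℕ i)) (suc (toℕ j)) (toℕ i)
                  (cong suc (sym (ℕP.+-suc (toℕ j) (toℕ i))))
  ... | false = refl

m∸[1+i]+[1+i]≡m : ∀ {m} (i : Fin m) → (m ∸ suc (toℕ i)) ℕ.+ suc (toℕ i) ≡ m
m∸[1+i]+[1+i]≡m i = ℕP.m∸n+n≡m (toℕ<n i)

m∸i+i≡m : ∀ {m} (i : Fin (suc m)) → (m ∸ toℕ i) ℕ.+ toℕ i ≡ m
m∸i+i≡m i = ℕP.m∸n+n≡m (ℕP.≤-pred (toℕ<n i))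

-- The rows of the theorem's matrix for n = m + 1 and s = s′ + 1: row i is fibRow (r + m - i),
-- where fibRow t = (F_{t-m+1}, …, F_t, F_{t+s}).
module _ (m s′ : ℕ) where

  fibRow : ℕ → Fin (suc m) → ℤ
  fibRow t j = if toℕ j <ᵇ m then F (suc m) (+ (t ℕ.+ suc (toℕ j)) - + m) else F (suc m) (+ (t ℕ.+ suc s′))

  fibMatrix : ℕ → Matrix (suc m)
  fibMatrix r i = fibRow (r ℕ.+ (m ∸ toℕ i))

  fibRow-recurrence : ∀ r j →
    fibRow (suc r ℕ.+ m) j ≡ fibRow r j + Σ m (λ i → fibRow (suc r ℕ.+ (m ∸ suc (toℕ i))) j)
  fibRow-recurrence r j with toℕ j <ᵇ m
  ... | true = begin
    F (suc m) (+ (suc r ℕ.+ m ℕ.+ suc (toℕ j)) - + m)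
      ≡⟨ F-cong-∸₀ (suc m) _ m (suc (suc (r ℕ.+ toℕ j))) (move r m (toℕ j)) ⟩
    F (suc m) (+ suc (suc (r ℕ.+ toℕ j)))
      ≡⟨ F-recurrence-last m (r ℕ.+ toℕ j) ⟩
    F (suc m) (+ suc (r ℕ.+ toℕ j) - + m) + Σ m (λ i → F (suc m) (+ suc (r ℕ.+ toℕ j) - + toℕ i))
      ≡⟨ cong₂ _+_ (F-cong-∸ (suc m) _ m _ m (cong (ℕ._+ m) (sym (ℕP.+-suc r (toℕ j)))))
                   (Σ-cong m λ i → F-cong-∸ (suc m) _ (toℕ i) _ m (split i)) ⟩
    F (suc m) (+ (r ℕ.+ suc (toℕ j)) - + m)
      + Σ m (λ i → F (suc m) (+ (suc r ℕ.+ (m ∸ suc (toℕ i)) ℕ.+ suc (toℕ j)) - + m)) ∎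
    where
    move : ∀ r m t → suc r ℕ.+ m ℕ.+ suc t ≡ suc (suc (r ℕ.+ t)) ℕ.+ m
    move = ℕ-Solver.solve-∀
    rearrange : ∀ r t k i → suc (r ℕ.+ t) ℕ.+ (k ℕ.+ suc i) ≡ suc r ℕ.+ k ℕ.+ suc t ℕ.+ i
    rearrange = ℕ-Solver.solve-∀
    split : ∀ (i : Fin m) →
      suc (r ℕ.+ toℕ j) ℕ.+ m ≡ suc r ℕ.+ (m ∸ suc (toℕ i)) ℕ.+ suc (toℕ j) ℕ.+ toℕ i
    split i = trans (cong (suc (r ℕ.+ toℕ j) ℕ.+_) (sym (m∸[1+i]+[1+i]≡m i)))
                    (rearrange r (toℕ j) (m ∸ suc (toℕ i)) (toℕ i))
  ... | false = begin
    F (suc m) (+ (suc r ℕ.+ m ℕ.+ suc s′))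
      ≡⟨ cong (λ t → F (suc m) (+ t)) (move r m s′) ⟩
    F (suc m) (+ suc (suc (r ℕ.+ m ℕ.+ s′)))
      ≡⟨ F-recurrence-last m (r ℕ.+ m ℕ.+ s′) ⟩
    F (suc m) (+ suc (r ℕ.+ m ℕ.+ s′) - + m) + Σ m (λ i → F (suc m) (+ suc (r ℕ.+ m ℕ.+ s′) - + toℕ i))
      ≡⟨ cong₂ _+_ (F-cong-∸₀ (suc m) _ m _ (swap r m s′))
                   (Σ-cong m λ i → F-cong-∸₀ (suc m) _ (toℕ i) _ (split i)) ⟩
    F (suc m) (+ (r ℕ.+ suc s′))
      + Σ m (λ i → F (suc m) (+ (suc r ℕ.+ (m ∸ suc (toℕ i)) ℕ.+ suc s′))) ∎
    where
    move : ∀ r m s → suc r ℕ.+ m ℕ.+ suc s ≡ suc (suc (r ℕ.+ m ℕ.+ s))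
    move = ℕ-Solver.solve-∀
    swap : ∀ r m s → suc (r ℕ.+ m ℕ.+ s) ≡ r ℕ.+ suc s ℕ.+ m
    swap = ℕ-Solver.solve-∀
    rearrange : ∀ r s k i → suc (r ℕ.+ (k ℕ.+ suc i) ℕ.+ s) ≡ suc r ℕ.+ k ℕ.+ suc s ℕ.+ i
    rearrange = ℕ-Solver.solve-∀
    split : ∀ (i : Fin m) →
      suc (r ℕ.+ m ℕ.+ s′) ≡ suc r ℕ.+ (m ∸ suc (toℕ i)) ℕ.+ suc s′ ℕ.+ toℕ i
    split i = trans (cong (λ z → suc (r ℕ.+ z ℕ.+ s′)) (sym (m∸[1+i]+[1+i]≡m i)))
                    (rearrange r s′ (m ∸ suc (toℕ i)) (toℕ i))

  headReplacedRow : ℕ → ℕ → Fin (suc m) → ℤ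
  headReplacedRow r zero    = fibRow r
  headReplacedRow r (suc t) = fibRow (suc r ℕ.+ (m ∸ suc t))

  replaceHead-fibMatrix : ∀ r x → replaceHead (fibRow r) (fibMatrix (suc r)) x ≡ headReplacedRow r (toℕ x)
  replaceHead-fibMatrix r zero    = refl
  replaceHead-fibMatrix r (suc x) = refl

  headReplacedRow-cycle : ∀ r i → headReplacedRow r (toℕ (cycle i)) ≡ fibMatrix r i
  headReplacedRow-cycle r i with ℕP.m≤n⇒m<n∨m≡n (ℕP.≤-pred (toℕ<n i))
  ... | inj₁ i<m rewrite toℕ-cycle-< i i<m =
    cong fibRow (trans (sym (ℕP.+-suc r (m ∸ suc (toℕ i)))) (cong (r ℕ.+_) (sym (ℕP.+-∸-assoc 1 i<m))))
  ... | inj₂ i≡m rewrite toℕ-cycle-last i i≡m | i≡m | ℕP.n∸n≡0 m | ℕP.+-identityʳ r = refl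

  det-fibMatrix₀ : det (suc m) (fibMatrix 0) ≡ F (suc m) (+ suc s′)
  det-fibMatrix₀ =
    trans (det-cong (suc m) staircase) (det-fibStaircase (suc m) m (λ k → F (suc m) (+ (k ℕ.+ suc s′))))
    where
    staircase : ∀ i j → fibMatrix 0 i j
      ≡ (if toℕ j <ᵇ m then F (suc m) (+ suc (toℕ j) - + toℕ i)
                       else F (suc m) (+ ((m ∸ toℕ i) ℕ.+ suc s′)))
    staircase i j with toℕ j <ᵇ m
    ... | true  = F-cong-∸ (suc m) _ m _ (toℕ i)
                    (trans (reorder (m ∸ toℕ i) (toℕ j) (toℕ i)) (cong (suc (toℕ j) ℕ.+_) (m∸i+i≡m i)))
      where
      reorder : ∀ k t i → k ℕ.+ suc t ℕ.+ i ≡ suc t ℕ.+ (k ℕ.+ i)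
      reorder = ℕ-Solver.solve-∀
    ... | false = refl

  det-fibMatrix : ∀ r → det (suc m) (fibMatrix r) ≡ sgn (m ℕ.* r) * F (suc m) (+ suc s′)
  det-fibMatrix zero = begin
    det (suc m) (fibMatrix 0)          ≡⟨ det-fibMatrix₀ ⟩
    F (suc m) (+ suc s′)               ≡⟨ sym (ℤP.*-identityˡ _) ⟩
    + 1 * F (suc m) (+ suc s′)         ≡⟨ cong (λ r → sgn r * F (suc m) (+ suc s′)) (sym (ℕP.*-zeroʳ m)) ⟩
    sgn (m ℕ.* 0) * F (suc m) (+ suc s′) ∎
  det-fibMatrix (suc r) = begin
    det (suc m) (fibMatrix (suc r))
      ≡⟨ det-addRowsToHead m (fibMatrix (suc r)) (fibRow r) (fibRow-recurrence r) ⟩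
    det (suc m) (replaceHead (fibRow r) (fibMatrix (suc r)))
      ≡⟨ det-cycle m (replaceHead (fibRow r) (fibMatrix (suc r))) ⟩
    sgn m * det (suc m) (replaceHead (fibRow r) (fibMatrix (suc r)) ∘ cycle)
      ≡⟨ cong (sgn m *_) (det-cong (suc m) λ i j →
           cong (λ row → row j) (trans (replaceHead-fibMatrix r (cycle i)) (headReplacedRow-cycle r i))) ⟩
    sgn m * det (suc m) (fibMatrix r)
      ≡⟨ cong (sgn m *_) (det-fibMatrix r) ⟩
    sgn m * (sgn (m ℕ.* r) * F (suc m) (+ suc s′))
      ≡⟨ sym (ℤP.*-assoc (sgn m) (sgn (m ℕ.* r)) _) ⟩
    sgn m * sgn (m ℕ.* r) * F (suc m) (+ suc s′)
      ≡⟨ cong (_* F (suc m) (+ suc s′)) (sym (trans (cong sgn (ℕP.*-suc m r)) (sgn-+ m (m ℕ.* r)))) ⟩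
    sgn (m ℕ.* suc r) * F (suc m) (+ suc s′) ∎

  fibMatrix-entries : ∀ r (i j : Fin (suc m)) →
    (if toℕ j <ᵇ m then F (suc m) (+ (r ℕ.+ 1 ℕ.+ toℕ j) - + toℕ i)
                   else F (suc m) (+ (r ℕ.+ suc m ℕ.+ suc s′) - + suc (toℕ i)))
      ≡ fibMatrix r i j
  fibMatrix-entries r i j with toℕ j <ᵇ m
  ... | true  = F-cong-∸ (suc m) _ (toℕ i) _ m
        (trans (cong (r ℕ.+ 1 ℕ.+ toℕ j ℕ.+_) (sym (m∸i+i≡m i))) (body r (toℕ j) (m ∸ toℕ i) (toℕ i)))
    where
    body : ∀ r t k i → r ℕ.+ 1 ℕ.+ t ℕ.+ (k ℕ.+ i) ≡ r ℕ.+ k ℕ.+ suc t ℕ.+ i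
    body = ℕ-Solver.solve-∀
  ... | false = F-cong-∸₀ (suc m) _ (suc (toℕ i)) _
        (trans (cong (λ z → r ℕ.+ suc z ℕ.+ suc s′) (sym (m∸i+i≡m i)))
               (last r s′ (m ∸ toℕ i) (toℕ i)))
    where
    last : ∀ r s k i → r ℕ.+ suc (k ℕ.+ i) ℕ.+ suc s ≡ r ℕ.+ k ℕ.+ suc s ℕ.+ suc i
    last = ℕ-Solver.solve-∀

mainTheorem4 : (n r s : ℕ) → n ≥ 2 → r ≥ 1 → s ≥ 1 →
    det n (λ i j → if toℕ j <ᵇ n ∸ 1
                     then F n (+ (r Data.Nat.+ 1 Data.Nat.+ toℕ j) - + toℕ i)
                     else F n (+ (r Data.Nat.+ n Data.Nat.+ s) - + suc (toℕ i)))
      ≡ sgn ((n ∸ 1) Data.Nat.* r) * F n (+ s)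
mainTheorem4 zero    _ _        () _ _
mainTheorem4 (suc m) _ zero     _  _ ()
mainTheorem4 (suc m) r (suc s′) _  _ _ =
  trans (det-cong (suc m) (fibMatrix-entries m s′ r)) (det-fibMatrix m s′ r)
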